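{- There is a function $\mathsf{cuts\text{ - }up}$ from proofs in $(\mathsf{Grz}+\mathsf{cut})^\infty$ to proofs in $(\mathsf{Grz}+\mathsf{cut})^\infty$ such that for every sequent $S$, if $\pi\vdash S$ then $\mathsf{cuts\text{ - }up}(\pi)\vdash S$ and $\mathsf{cuts\text{ - }up}(\pi)$ has no instance of (cut) in its main fragment.
   Context: Formulas are built from propositional variables, $\bot$, $\to$, $\Box$. A sequent is a pair $(\Gamma,\Delta)$ of finite multisets of formulas; $S,\phi^\bullet$ means $S\cup(\{\phi\},\varnothing)$, $S,\phi^\circ$ means $S\cup(\varnothing,\{\phi\})$ (componentwise multiset union), similarly for multisets; $\Box\Pi=\{\Box\psi:\psi\in\Pi\}$. Rules (premises in order $0,1$): (Ax) conclusion $S,p^\bullet,p^\circ$, no premises; ($\bot^\bullet$) conclusion $S,\bot^\bullet$, no premises; ($\to^\bullet$) premises $S,\phi^\circ$ and $S,\psi^\bullet$, conclusion $S,(\phi\to\psi)^\bullet$; ($\to^\circ$) premise $S,\phi^\bullet,\psi^\circ$, conclusion $S,(\phi\to\psi)^\circ$; (Refl) premise $S,\phi^\bullet,\Box\phi^\bullet$, conclusion $S,\Box\phi^\bullet$; ($\Box$) premises $S,\Box\Pi^\bullet,\phi^\circ$ and $\Box\Pi^\bullet,\phi^\circ$, conclusion $S,\Box\Pi^\bullet,\Box\phi^\circ$; (cut) premises $S,\phi^\circ$ and $S,\phi^\bullet$, conclusion $S$. A proof in $(\mathsf{Grz}+\mathsf{cut})^\infty$ is a finitely branching, possibly infinite tree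 (nodes are words over $\mathbb{N}$, children of $w$ are $w0,w1,\dots$) labelled by a sequent and a rule, each node with its children forming an instance of its rule, such that every infinite branch passes infinitely often through a node that is the right premise (child 1) of a $(\Box)$-instance. $\pi\vdash S$ means the root sequent is $S$. The main fragment of $\pi$ is the set of nodes $w$ such that no node $u$ with $\epsilon\neq u\sqsubseteq w$ is the right premise of a $(\Box)$-instance; "no instance of (cut) in the main fragment" means no node in this set is labelled (cut). -}

module Defs where

open import Data.Nat using (ℕ; _<_; _≤_)
open import Data.List using (List; []; _∷_; _++_; map)
open import Data.List.Relation.Binary.Permutation.Propositional using (_↭_)
open import Data.Product using (Σ; ∃; ∃-syntax; _×_; _,_; proj₁; proj₂)
open import Data.Empty using (⊥)
open import Data.Unit using (⊤)
open import Relation.Binary.PropositionalEquality using (_≡_; _≢_)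
open import Relation.Nullary using (¬_)

data Fm : Set where
  var  : ℕ → Fm
  bot  : Fm
  _⇒_  : Fm → Fm → Fm
  box  : Fm → Fm

-- Finite multisets of formulas are represented by lists, compared up to
-- permutation (_↭_).  A sequent is a pair (Γ , Δ).
Sequent : Set
Sequent = List Fm × List Fm

_≈_ : Sequent → Sequent → Set
(Γ , Δ) ≈ (Γ′ , Δ′) = (Γ ↭ Γ′) × (Δ ↭ Δ′)

_∪_ : Sequent → Sequent → Sequent
(Γ , Δ) ∪ (Γ′ , Δ′) = (Γ ++ Γ′ , Δ ++ Δ′)

_,•_ : Sequent → Fm → Sequent
S ,• φ = S ∪ (φ ∷ [] , [])

_,∘_ : Sequent → Fm → Sequent
S ,∘ φ = S ∪ ([] , φ ∷ [])

_,•*_ : Sequent → List Fm → Sequent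
S ,•* Π = S ∪ (Π , [])

□_ : List Fm → List Fm
□ Π = map box Π

infixl 5 _,•_ _,∘_ _,•*_

data Rule : Set where
  Ax bot• imp• imp∘ Refl Box Cut : Rule

arity : Rule → ℕ
arity Ax   = 0
arity bot• = 0
arity imp• = 2
arity imp∘ = 1
arity Refl = 1
arity Box  = 2
arity Cut  = 2

Inst : Rule → Sequent → (ℕ → Sequent) → Set
Inst Ax   C P = ∃[ S ] ∃[ p ] (C ≈ (S ,• var p ,∘ var p))
Inst bot• C P = ∃[ S ] (C ≈ (S ,• bot))
Inst imp• C P = ∃[ S ] ∃[ φ ] ∃[ ψ ]
  ((C ≈ (S ,• (φ ⇒ ψ))) × (P 0 ≈ (S ,∘ φ)) × (P 1 ≈ (S ,• ψ)))
Inst imp∘ C P = ∃[ S ] ∃[ φ ] ∃[ ψ ]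
  ((C ≈ (S ,∘ (φ ⇒ ψ))) × (P 0 ≈ (S ,• φ ,∘ ψ)))
Inst Refl C P = ∃[ S ] ∃[ φ ]
  ((C ≈ (S ,• box φ)) × (P 0 ≈ (S ,• φ ,• box φ)))
Inst Box  C P = ∃[ S ] ∃[ Π ] ∃[ φ ]
  ((C ≈ (S ,•* □ Π ,∘ box φ)) × (P 0 ≈ (S ,•* □ Π ,∘ φ))
    × (P 1 ≈ ((□ Π , []) ,∘ φ)))
Inst Cut  C P = ∃[ S ] ∃[ φ ]
  ((C ≈ S) × (P 0 ≈ (S ,∘ φ)) × (P 1 ≈ (S ,• φ)))

-- Nodes are words over ℕ; the children of w are w ++ [i].
Word : Set
Word = List ℕ

-- A labelled tree: every word gets a label (sequent, rule); the actual tree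
-- (set of nodes) is generated from the root by the arities of the rules,
-- so it is finitely branching.  Labels outside the node set are irrelevant.
record PreProof : Set where
  field
    seq  : Word → Sequent
    rule : Word → Rule
open PreProof public

data Node (π : PreProof) : Word → Set where
  root  : Node π []
  child : ∀ {w} i → Node π w → i < arity (rule π w) → Node π (w ++ i ∷ [])

RightBoxPremise : PreProof → Word → Set
RightBoxPremise π u = ∃[ w ] ((u ≡ w ++ 1 ∷ []) × (rule π w ≡ Box))

_⊑_ : Word → Word → Set
u ⊑ w = ∃[ v ] (u ++ v ≡ w)

branch : (ℕ → ℕ) → ℕ → Word
branch b ℕ.zero    = []
branch b (ℕ.suc n) = branch b n ++ b n ∷ []

LocallyCorrect : PreProof → Set
LocallyCorrect π = ∀ w → Node π w →
  Inst (rule π w) (seq π w) (λ i → seq π (w ++ i ∷ []))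

Progressing : PreProof → Set
Progressing π = ∀ (b : ℕ → ℕ) → (∀ n → Node π (branch b n)) →
  ∀ n → ∃[ m ] ((n ≤ m) × RightBoxPremise π (branch b m))

record Proof : Set where
  field
    tree        : PreProof
    correct     : LocallyCorrect tree
    progressing : Progressing tree
open Proof public

_⊢_ : Proof → Sequent → Set
π ⊢ S = seq (tree π) [] ≈ S

MainFragment : Proof → Word → Set
MainFragment π w = Node (tree π) w ×
  (∀ u → u ≢ [] → u ⊑ w → ¬ RightBoxPremise (tree π) u)

NoCutInMain : Proof → Set
NoCutInMain π = ∀ w → MainFragment π w → rule (tree π) w ≢ Cut

{-# OPTIONS --safe #-}

-- Cut elimination is done semantically, through finite trees read as
-- reflexive-transitive Kripke models.  No such tree refutes the root of a
-- proof: it could be pushed up a branch to refute every node on it, its height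
-- never growing and dropping at each right premise of (□), which the branch
-- meets infinitely often.  Conversely, a terminating search for cut-free
-- derivations either builds a refuting tree or a finite derivation in which a
-- right premise of (□) may cycle back to an identical pending one; termination
-- holds because such premises □Π•, φ° range over a finite set once Π is kept
-- duplicate-free and made of subformulas.  Unfolding the cycles yields a
-- cut-free proof whose only infinite branches run through the cycles, hence
-- through right premises of (□).

module Submission where

open import Defs
open import Level using (0ℓ)
open import Function using (_∘_)
open import Data.Empty using (⊥; ⊥-elim)
open import Data.Unit using (⊤; tt)
open import Data.Bool using (Bool; true; false; not; _∧_; _∨_)
open import Data.Bool.Properties using (∧-conicalˡ; ∧-conicalʳ; ∧-zeroʳ; ∨-zeroʳ)
import Data.Nat as ℕ
open import Data.Nat
  using (ℕ; zero; suc; _+_; _<_; _≤_; _≤′_; ≤′-refl; ≤′-step; _⊔_; z≤n; s≤s)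
open import Data.Nat.Properties
  using (≤-refl; ≤-trans; <-≤-trans; <⇒≤; ≤-pred; ≤⇒≤′; n≮0; n≮n; n≤1+n; n<1+n;
         m≤n⇒m≤1+n; m≤m⊔n; m≤n⊔m; m≤n+m; +-suc; +-identityʳ; module ≤-Reasoning)
open import Data.Nat.Induction using (<-wellFounded)
open import Data.Nat.ListAction using (sum)
open import Data.Nat.ListAction.Properties using (sum-↭)
open import Data.Nat.Tactic.RingSolver using (solve-∀)
open import Data.Product using (Σ; ∃-syntax; _×_; _,_; proj₁; proj₂)
import Data.Product.Properties as ×
open import Data.Sum using (_⊎_; inj₁; inj₂; fromInj₁)
import Data.Sum.Effectful.Left as SumLeft
open import Data.List
  using (List; []; _∷_; _++_; [_]; map; foldl; length; cartesianProduct; cartesianProductWith)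
import Data.List.Properties as List
open import Data.List.Properties using (∷ʳ-injective; foldl-++; ++-identityʳ)
open import Data.List.Relation.Unary.All as All using (All; []; _∷_)
import Data.List.Relation.Unary.All.Properties as All
open import Data.List.Relation.Unary.Any using (Any; here; there; any?)
open import Data.List.Relation.Unary.Unique.Propositional using (Unique; []; _∷_)
open import Data.List.Membership.Propositional using (_∈_; _∉_; find)
open import Data.List.Membership.Propositional.Properties
  using (∈-∃++; ∈-++⁺ˡ; ∈-++⁺ʳ; ∈-++⁻; ∈-cartesianProductWith⁺; ∈-cartesianProduct⁺)
open import Data.List.Relation.Binary.Permutation.Propositional
  using (_↭_; ↭-refl; ↭-sym; ↭-trans; ↭-reflexive)
open import Data.List.Relation.Binary.Permutation.Propositional.Properties
  using (All-resp-↭; ∈-resp-↭; ↭-length; shift; ∷↭∷ʳ; ++⁺ˡ; ++⁺ʳ; map⁺; ++-commutativeMonoid)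
open import Algebra.Solver.CommutativeMonoid (++-commutativeMonoid {A = Fm})
  using (solve; _⊜_; _⊕_; id)
open import Induction.WellFounded using (Acc; acc)
open import Relation.Binary.Definitions using (DecidableEquality)
open import Relation.Binary.PropositionalEquality
  using (_≡_; _≢_; refl; sym; trans; cong; cong₂; subst)
open import Relation.Nullary using (¬_; yes; no; does; map′; _×-dec_)
open import Relation.Nullary.Decidable using (dec-true; dec-false)

≈-refl : ∀ {S} → S ≈ S
≈-refl {_ , _} = ↭-refl , ↭-refl

≈-sym : ∀ {S S′} → S ≈ S′ → S′ ≈ S
≈-sym {_ , _} {_ , _} (p , q) = ↭-sym p , ↭-sym q

≈-trans : ∀ {S S′ S″} → S ≈ S′ → S′ ≈ S″ → S ≈ S″
≈-trans {_ , _} {_ , _} {_ , _} (p , q) (p′ , q′) = ↭-trans p p′ , ↭-trans q q′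

∷ˡ≈,• : ∀ θ Γ Δ → (θ ∷ Γ , Δ) ≈ ((Γ , Δ) ,• θ)
∷ˡ≈,• θ Γ Δ = ∷↭∷ʳ θ Γ , ↭-reflexive (sym (++-identityʳ Δ))

∷ʳ≈,∘ : ∀ θ Γ Δ → (Γ , θ ∷ Δ) ≈ ((Γ , Δ) ,∘ θ)
∷ʳ≈,∘ θ Γ Δ = ↭-reflexive (sym (++-identityʳ Γ)) , ∷↭∷ʳ θ Δ

,∘-cong : ∀ {S S′} φ → S ≈ S′ → (S ,∘ φ) ≈ (S′ ,∘ φ)
,∘-cong {_ , _} {_ , _} φ (p , q) = ++⁺ʳ [] p , ++⁺ʳ [ φ ] q

∷∷≈,•,∘ : ∀ θ η Γ Δ → (θ ∷ Γ , η ∷ Δ) ≈ ((Γ , Δ) ,• θ ,∘ η)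
∷∷≈,•,∘ θ η Γ Δ = ≈-trans (∷ʳ≈,∘ η (θ ∷ Γ) Δ) (,∘-cong η (∷ˡ≈,• θ Γ Δ))

-- Finite Kripke models

data Tree : Set where
  node : (ℕ → Bool) → List Tree → Tree

mutual
  eval : Tree → Fm → Bool
  eval t           bot     = false
  eval t           (φ ⇒ ψ) = not (eval t φ) ∨ eval t ψ
  eval (node v ts) (var p) = v p
  eval (node v ts) (box φ) = eval (node v ts) φ ∧ evalBoxAll ts φ

  evalBoxAll : List Tree → Fm → Bool
  evalBoxAll []       φ = true
  evalBoxAll (t ∷ ts) φ = eval t (box φ) ∧ evalBoxAll ts φ

_⊨_ : Tree → Fm → Set
t ⊨ φ = eval t φ ≡ true

_⊭_ : Tree → Fm → Set
t ⊭ φ = eval t φ ≡ false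

children : Tree → List Tree
children (node _ ts) = ts

_⊨↑_ : Tree → Fm → Set
t ⊨↑ φ = evalBoxAll (children t) φ ≡ true

⊨-⊭-disjoint : ∀ t {φ} → t ⊨ φ → t ⊭ φ → ⊥
⊨-⊭-disjoint t ⊨φ ⊭φ with () ← trans (sym ⊨φ) ⊭φ

Refutes : Tree → Sequent → Set
Refutes t (Γ , Δ) = All (t ⊨_) Γ × All (t ⊭_) Δ

mutual
  height : Tree → ℕ
  height (node _ ts) = suc (maxHeight ts)

  maxHeight : List Tree → ℕ
  maxHeight []       = 0
  maxHeight (t ∷ ts) = height t ⊔ maxHeight ts

refutes-resp-≈ : ∀ {t S S′} → S ≈ S′ → Refutes t S → Refutes t S′
refutes-resp-≈ {S = _ , _} {_ , _} (p , q) (⊨Γ , ⊭Δ) = All-resp-↭ p ⊨Γ , All-resp-↭ q ⊭Δ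

refutes-•⁻ : ∀ {t} S φ → Refutes t (S ,• φ) → Refutes t S × t ⊨ φ
refutes-•⁻ (Γ , Δ) φ (⊨Γφ , ⊭Δ) with All.++⁻ Γ ⊨Γφ
... | ⊨Γ , ⊨φ ∷ [] = (⊨Γ , All.++⁻ˡ Δ ⊭Δ) , ⊨φ

refutes-∘⁻ : ∀ {t} S φ → Refutes t (S ,∘ φ) → Refutes t S × t ⊭ φ
refutes-∘⁻ (Γ , Δ) φ (⊨Γ , ⊭Δφ) with All.++⁻ Δ ⊭Δφ
... | ⊭Δ , ⊭φ ∷ [] = (All.++⁻ˡ Γ ⊨Γ , ⊭Δ) , ⊭φ

refutes-•*⁻ : ∀ {t} S Π → Refutes t (S ,•* Π) → Refutes t S × All (t ⊨_) Π
refutes-•*⁻ (Γ , Δ) Π (⊨ΓΠ , ⊭Δ) = (All.++⁻ˡ Γ ⊨ΓΠ , All.++⁻ˡ Δ ⊭Δ) , All.++⁻ʳ Γ ⊨ΓΠ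

refutes-•⁺ : ∀ {t} S φ → Refutes t S → t ⊨ φ → Refutes t (S ,• φ)
refutes-•⁺ (Γ , Δ) φ (⊨Γ , ⊭Δ) ⊨φ = All.++⁺ ⊨Γ (⊨φ ∷ []) , All.++⁺ ⊭Δ []

refutes-∘⁺ : ∀ {t} S φ → Refutes t S → t ⊭ φ → Refutes t (S ,∘ φ)
refutes-∘⁺ (Γ , Δ) φ (⊨Γ , ⊭Δ) ⊭φ = All.++⁺ ⊨Γ [] , All.++⁺ ⊭Δ (⊭φ ∷ [])

⊨□⇒⊨ : ∀ t {φ} → t ⊨ box φ → t ⊨ φ
⊨□⇒⊨ (node v ts) {φ} = ∧-conicalˡ _ (evalBoxAll ts φ)

⊨⇒-cases : ∀ t {φ ψ} → t ⊨ (φ ⇒ ψ) → t ⊭ φ ⊎ t ⊨ ψ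
⊨⇒-cases t {φ} ⊨φ⇒ψ with eval t φ
... | false = inj₁ refl
... | true  = inj₂ ⊨φ⇒ψ

⊭⇒-cases : ∀ t {φ ψ} → t ⊭ (φ ⇒ ψ) → t ⊨ φ × t ⊭ ψ
⊭⇒-cases t {φ} ⊭φ⇒ψ with eval t φ
⊭⇒-cases t {φ} ()   | false
⊭⇒-cases t {φ} ⊭φ⇒ψ | true = refl , ⊭φ⇒ψ

⊨⇒-introˡ : ∀ t {φ ψ} → t ⊭ φ → t ⊨ (φ ⇒ ψ)
⊨⇒-introˡ t ⊭φ rewrite ⊭φ = refl

⊨⇒-introʳ : ∀ t {φ ψ} → t ⊨ ψ → t ⊨ (φ ⇒ ψ)
⊨⇒-introʳ t {φ} ⊨ψ rewrite ⊨ψ = ∨-zeroʳ (not (eval t φ))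

⊭⇒-intro : ∀ t {φ ψ} → t ⊨ φ → t ⊭ ψ → t ⊭ (φ ⇒ ψ)
⊭⇒-intro t ⊨φ ⊭ψ rewrite ⊨φ | ⊭ψ = refl

⊨□-intro : ∀ t {φ} → t ⊨ φ → t ⊨↑ φ → t ⊨ box φ
⊨□-intro (node v ts) ⊨φ ⊨↑φ rewrite ⊨φ | ⊨↑φ = refl

⊭□-intro : ∀ t {φ} → t ⊭ φ → t ⊭ box φ
⊭□-intro (node v ts) ⊭φ rewrite ⊭φ = refl

evalBoxAll-true : ∀ {ts φ} → All (_⊨ box φ) ts → evalBoxAll ts φ ≡ true
evalBoxAll-true []          = refl
evalBoxAll-true (⊨□φ ∷ ⊨ts) rewrite ⊨□φ = evalBoxAll-true ⊨ts

evalBoxAll-false : ∀ {ts φ} → Any (_⊭ box φ) ts → evalBoxAll ts φ ≡ false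
evalBoxAll-false (here ⊭□φ)  rewrite ⊭□φ = refl
evalBoxAll-false (there ⊭ts) rewrite evalBoxAll-false ⊭ts = ∧-zeroʳ _

node-⊭□ : ∀ v ts {φ} → Any (_⊭ box φ) ts → node v ts ⊭ box φ
node-⊭□ v ts {φ} ⊭ts rewrite evalBoxAll-false ⊭ts = ∧-zeroʳ (eval (node v ts) φ)

mutual
  ⊭□⇒subtree⊭ : ∀ t {φ} Π → t ⊭ box φ → All (λ π → t ⊨ box π) Π →
                Σ Tree λ d → height d ≤ height t × d ⊭ φ × All (λ π → d ⊨ box π) Π
  ⊭□⇒subtree⊭ (node v ts) {φ} Π ⊭□φ ⊨□Π with eval (node v ts) φ in eq
  ... | false = node v ts , ≤-refl , eq , ⊨□Π
  ... | true with ⊭□⇒subtrees⊭ ts Π ⊭□φ (All.map (λ {π} → ∧-conicalʳ (eval (node v ts) π) _) ⊨□Π)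
  ...   | d , d≤ , ⊭φ , ⊨□Π′ = d , m≤n⇒m≤1+n d≤ , ⊭φ , ⊨□Π′

  ⊭□⇒subtrees⊭ : ∀ ts {φ} Π → evalBoxAll ts φ ≡ false → All (λ π → evalBoxAll ts π ≡ true) Π →
                 Σ Tree λ d → height d ≤ maxHeight ts × d ⊭ φ × All (λ π → d ⊨ box π) Π
  ⊭□⇒subtrees⊭ [] Π () ⊨□Π
  ⊭□⇒subtrees⊭ (t ∷ ts) {φ} Π ⊭□φ ⊨□Π with eval t (box φ) in eq
  ... | false with ⊭□⇒subtree⊭ t Π eq (All.map (λ {π} → ∧-conicalˡ _ (evalBoxAll ts π)) ⊨□Π)
  ...   | d , d≤ , ⊭φ , ⊨□Π′ = d , ≤-trans d≤ (m≤m⊔n _ _) , ⊭φ , ⊨□Π′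
  ⊭□⇒subtrees⊭ (t ∷ ts) {φ} Π ⊭□φ ⊨□Π | true
    with ⊭□⇒subtrees⊭ ts Π ⊭□φ (All.map (λ {π} → ∧-conicalʳ (eval t (box π)) _) ⊨□Π)
  ...   | d , d≤ , ⊭φ , ⊨□Π′ = d , ≤-trans d≤ (m≤n⊔m (height t) _) , ⊭φ , ⊨□Π′

⊭□⇒proper-subtree⊭ : ∀ t {φ} Π → t ⊭ box φ → t ⊨ φ → All (λ π → t ⊨ box π) Π →
                     Σ Tree λ d → height d < height t × d ⊭ φ × All (λ π → d ⊨ box π) Π
⊭□⇒proper-subtree⊭ (node v ts) {φ} Π ⊭□φ ⊨φ ⊨□Π
  with ⊭□⇒subtrees⊭ ts Π (subst (λ b → b ∧ evalBoxAll ts φ ≡ false) ⊨φ ⊭□φ)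
         (All.map (λ {π} → ∧-conicalʳ (eval (node v ts) π) _) ⊨□Π)
... | d , d≤ , ⊭φ , ⊨□Π′ = d , s≤s d≤ , ⊭φ , ⊨□Π′

-- Soundness

record RefutedPremise (t : Tree) (r : Rule) (P : ℕ → Sequent) : Set where
  field
    index       : ℕ
    index<arity : index < arity r
    model       : Tree
    refutes     : Refutes model (P index)
    height-≤    : height model ≤ height t
    height-<    : r ≡ Box → index ≡ 1 → height model < height t

same-model : ∀ {t r P} i → i < arity r → Refutes t (P i) → (r ≡ Box → i ≡ 1 → ⊥) →
             RefutedPremise t r P
same-model {t} i i<arity R not-right = record
  { index = i ; index<arity = i<arity ; model = t ; refutes = R
  ; height-≤ = ≤-refl ; height-< = λ r≡Box i≡1 → ⊥-elim (not-right r≡Box i≡1) }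

refuted-premise : ∀ {t} r {C P} → Inst r C P → Refutes t C → RefutedPremise t r P
refuted-premise {t} Ax (S , p , C≈) R
  with R′ , ⊭p ← refutes-∘⁻ (S ,• var p) (var p) (refutes-resp-≈ C≈ R)
  with _ , ⊨p ← refutes-•⁻ S (var p) R′
  = ⊥-elim (⊨-⊭-disjoint t {var p} ⊨p ⊭p)
refuted-premise bot• (S , C≈) R with () ← proj₂ (refutes-•⁻ S bot (refutes-resp-≈ C≈ R))
refuted-premise {t} imp• (S , φ , ψ , C≈ , P₀≈ , P₁≈) R
  with RS , ⊨φ⇒ψ ← refutes-•⁻ S (φ ⇒ ψ) (refutes-resp-≈ C≈ R)
  with ⊨⇒-cases t {φ} {ψ} ⊨φ⇒ψ
... | inj₁ ⊭φ = same-model 0 (s≤s z≤n) (refutes-resp-≈ (≈-sym P₀≈) (refutes-∘⁺ S φ RS ⊭φ)) λ ()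
... | inj₂ ⊨ψ = same-model 1 (s≤s (s≤s z≤n)) (refutes-resp-≈ (≈-sym P₁≈) (refutes-•⁺ S ψ RS ⊨ψ)) λ ()
refuted-premise {t} imp∘ (S , φ , ψ , C≈ , P₀≈) R
  with RS , ⊭φ⇒ψ ← refutes-∘⁻ S (φ ⇒ ψ) (refutes-resp-≈ C≈ R)
  with ⊨φ , ⊭ψ ← ⊭⇒-cases t {φ} {ψ} ⊭φ⇒ψ
  = same-model 0 (s≤s z≤n)
      (refutes-resp-≈ (≈-sym P₀≈) (refutes-∘⁺ (S ,• φ) ψ (refutes-•⁺ S φ RS ⊨φ) ⊭ψ)) λ ()
refuted-premise {t} Refl (S , φ , C≈ , P₀≈) R
  with RS , ⊨□φ ← refutes-•⁻ S (box φ) (refutes-resp-≈ C≈ R)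
  = same-model 0 (s≤s z≤n)
      (refutes-resp-≈ (≈-sym P₀≈)
        (refutes-•⁺ (S ,• φ) (box φ) (refutes-•⁺ S φ RS (⊨□⇒⊨ t ⊨□φ)) ⊨□φ)) λ ()
refuted-premise {t} Box (S , Π , φ , C≈ , P₀≈ , P₁≈) R
  with RSΠ , ⊭□φ ← refutes-∘⁻ (S ,•* □ Π) (box φ) (refutes-resp-≈ C≈ R)
  with RS , ⊨□Π ← refutes-•*⁻ S (□ Π) RSΠ
  with eval t φ in eq
... | false = same-model 0 (s≤s z≤n)
                (refutes-resp-≈ (≈-sym P₀≈) (refutes-∘⁺ (S ,•* □ Π) φ RSΠ eq)) λ _ ()
... | true with d , d<t , ⊭φ , ⊨□Π′ ← ⊭□⇒proper-subtree⊭ t Π ⊭□φ eq (All.map⁻ ⊨□Π) = record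
  { index = 1 ; index<arity = s≤s (s≤s z≤n) ; model = d
  ; refutes = refutes-resp-≈ (≈-sym P₁≈) (refutes-∘⁺ (□ Π , []) φ (All.map⁺ ⊨□Π′ , []) ⊭φ)
  ; height-≤ = <⇒≤ d<t ; height-< = λ _ _ → d<t }
refuted-premise {t} Cut (S , φ , C≈ , P₀≈ , P₁≈) R with eval t φ in eq
... | false = same-model 0 (s≤s z≤n)
                (refutes-resp-≈ (≈-sym P₀≈) (refutes-∘⁺ S φ (refutes-resp-≈ C≈ R) eq)) λ ()
... | true  = same-model 1 (s≤s (s≤s z≤n))
                (refutes-resp-≈ (≈-sym P₁≈) (refutes-•⁺ S φ (refutes-resp-≈ C≈ R) eq)) λ ()

no-infinite-descent : (h : ℕ → ℕ) → (∀ n → h (suc n) ≤ h n) →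
                      (∀ n → ∃[ m ] (n ≤ m × h (suc m) < h m)) → ⊥
no-infinite-descent h step descends = bounded (h 0) 0 ≤-refl
  where
  antitone : ∀ {n m} → n ≤′ m → h m ≤ h n
  antitone ≤′-refl        = ≤-refl
  antitone (≤′-step n≤′m) = ≤-trans (step _) (antitone n≤′m)

  bounded : ∀ k n → h n ≤ k → ⊥
  bounded k n hn≤k with m , n≤m , drop ← descends n with k
  ... | zero  = n≮0 (<-≤-trans drop (≤-trans (antitone (≤⇒≤′ n≤m)) hn≤k))
  ... | suc k = bounded k (suc m) (≤-pred (<-≤-trans drop (≤-trans (antitone (≤⇒≤′ n≤m)) hn≤k)))

module RefutationWalk (π : Proof) where

  record Visit : Set where
    field
      word    : Word
      isNode  : Node (tree π) word
      model   : Tree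
      refutes : Refutes model (seq (tree π) word)
  open Visit

  next-premise : (v : Visit) →
    RefutedPremise (model v) (rule (tree π) (word v)) (λ i → seq (tree π) (word v ++ i ∷ []))
  next-premise v = refuted-premise (rule (tree π) (word v)) (correct π (word v) (isNode v)) (refutes v)

  next : Visit → Visit
  next v = record
    { word = word v ++ index ∷ [] ; isNode = child index (isNode v) index<arity
    ; model = RP.model ; refutes = RP.refutes }
    where
    module RP = RefutedPremise (next-premise v)
    open RP using (index; index<arity)

  module _ (t : Tree) (R : Refutes t (seq (tree π) [])) where
    visits : ℕ → Visit
    visits zero    = record { word = [] ; isNode = root ; model = t ; refutes = R }
    visits (suc n) = next (visits n)

    choices : ℕ → ℕ
    choices n = RefutedPremise.index (next-premise (visits n))

    word-visits : ∀ n → word (visits n) ≡ branch choices n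
    word-visits zero    = refl
    word-visits (suc n) = cong (_++ choices n ∷ []) (word-visits n)

    height-at : ℕ → ℕ
    height-at n = height (model (visits n))

    right-□-premise-descends : ∀ n → ∃[ m ] (n ≤ m × height-at (suc m) < height-at m)
    right-□-premise-descends n
      with progressing π choices (λ k → subst (Node (tree π)) (word-visits k) (isNode (visits k)))
                       (suc n)
    ... | suc m , s≤s n≤m , w , eq , rule≡Box
      with w≡ , choice≡1 ← ∷ʳ-injective (branch choices m) w eq
      = m , n≤m , RefutedPremise.height-< (next-premise (visits m))
                    (trans (cong (rule (tree π)) (trans (word-visits m) w≡)) rule≡Box) choice≡1

    absurd : ⊥
    absurd = no-infinite-descent height-at (λ n → RefutedPremise.height-≤ (next-premise (visits n)))
               right-□-premise-descends

soundness : (π : Proof) (t : Tree) → ¬ Refutes t (seq (tree π) [])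
soundness π = RefutationWalk.absurd π

-- Cyclic cut-free derivations and their unfolding

Goal : Set
Goal = List Fm × Fm

goal : Goal → Sequent
goal (Π , φ) = (□ Π , []) ,∘ φ

-- H lists the goals of the enclosing right (□)-premises; a right premise
-- may be closed by a cycle back to one of them.
mutual
  data Derivation (H : List Goal) : Sequent → Set where
    axiom       : ∀ {C} S p → C ≈ (S ,• var p ,∘ var p) → Derivation H C
    ⊥-left      : ∀ {C} S → C ≈ (S ,• bot) → Derivation H C
    ⇒-left      : ∀ {C} S φ ψ → C ≈ (S ,• (φ ⇒ ψ)) →
                  Derivation H (S ,∘ φ) → Derivation H (S ,• ψ) → Derivation H C
    ⇒-right     : ∀ {C} S φ ψ → C ≈ (S ,∘ (φ ⇒ ψ)) → Derivation H (S ,• φ ,∘ ψ) → Derivation H C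
    reflexivity : ∀ {C} S φ → C ≈ (S ,• box φ) → Derivation H (S ,• φ ,• box φ) → Derivation H C
    □-right     : ∀ {C} S Π φ → C ≈ (S ,•* □ Π ,∘ box φ) →
                  Derivation H (S ,•* □ Π ,∘ φ) → BoxPremise H (Π , φ) → Derivation H C

  data BoxPremise (H : List Goal) : Goal → Set where
    back  : ∀ {k} → k ∈ H → BoxPremise H k
    fresh : ∀ {k} → Derivation (k ∷ H) (goal k) → BoxPremise H k

derivation-resp-≈ : ∀ {H C C′} → C′ ≈ C → Derivation H C → Derivation H C′
derivation-resp-≈ C′≈ (axiom S p C≈)          = axiom S p (≈-trans C′≈ C≈)
derivation-resp-≈ C′≈ (⊥-left S C≈)           = ⊥-left S (≈-trans C′≈ C≈)
derivation-resp-≈ C′≈ (⇒-left S φ ψ C≈ d₀ d₁)  = ⇒-left S φ ψ (≈-trans C′≈ C≈) d₀ d₁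
derivation-resp-≈ C′≈ (⇒-right S φ ψ C≈ d)    = ⇒-right S φ ψ (≈-trans C′≈ C≈) d
derivation-resp-≈ C′≈ (reflexivity S φ C≈ d)  = reflexivity S φ (≈-trans C′≈ C≈) d
derivation-resp-≈ C′≈ (□-right S Π φ C≈ d b)  = □-right S Π φ (≈-trans C′≈ C≈) d b

size : ∀ {H C} → Derivation H C → ℕ
size (axiom _ _ _)          = 0
size (⊥-left _ _)           = 0
size (⇒-left _ _ _ _ d₀ d₁) = suc (size d₀ ⊔ size d₁)
size (⇒-right _ _ _ _ d)    = suc (size d)
size (reflexivity _ _ _ d)  = suc (size d)
size (□-right _ _ _ _ d _)  = suc (size d)

Companions : List Goal → Set
Companions []      = ⊤
Companions (k ∷ H) = Derivation (k ∷ H) (goal k) × Companions H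

record Position : Set where
  constructor position
  field
    goals      : List Goal
    companions : Companions goals
    sequent    : Sequent
    derivation : Derivation goals sequent
open Position

companion : ∀ {k H} → k ∈ H → Companions H → Position
companion {k} (here refl) (d , cs) = position _ (d , cs) (goal k) d
companion     (there k∈H) (_ , cs) = companion k∈H cs

companion-sequent : ∀ {k H} (k∈H : k ∈ H) (cs : Companions H) → sequent (companion k∈H cs) ≡ goal k
companion-sequent (here refl) _        = refl
companion-sequent (there k∈H) (_ , cs) = companion-sequent k∈H cs

premise : Position → ℕ → Position
premise (position H cs _ (⇒-left _ _ _ _ d₀ _))     0 = position H cs _ d₀
premise (position H cs _ (⇒-left _ _ _ _ _ d₁))     1 = position H cs _ d₁
premise (position H cs _ (⇒-right _ _ _ _ d))       0 = position H cs _ d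
premise (position H cs _ (reflexivity _ _ _ d))     0 = position H cs _ d
premise (position H cs _ (□-right _ _ _ _ d _))     0 = position H cs _ d
premise (position H cs _ (□-right _ _ _ _ _ (back k∈H)))  1 = companion k∈H cs
premise (position H cs _ (□-right _ Π φ _ _ (fresh d)))   1 = position ((Π , φ) ∷ H) (d , cs) _ d
premise p _ = p

rule-at : Position → Rule
rule-at p with derivation p
... | axiom _ _ _          = Ax
... | ⊥-left _ _           = bot•
... | ⇒-left _ _ _ _ _ _   = imp•
... | ⇒-right _ _ _ _ _    = imp∘
... | reflexivity _ _ _ _  = Refl
... | □-right _ _ _ _ _ _  = Box

rule-at≢Cut : ∀ p → rule-at p ≢ Cut
rule-at≢Cut p with derivation p
... | axiom _ _ _          = λ ()
... | ⊥-left _ _           = λ ()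
... | ⇒-left _ _ _ _ _ _   = λ ()
... | ⇒-right _ _ _ _ _    = λ ()
... | reflexivity _ _ _ _  = λ ()
... | □-right _ _ _ _ _ _  = λ ()

inst-at : ∀ p → Inst (rule-at p) (sequent p) (λ i → sequent (premise p i))
inst-at (position _ _ _ (axiom S p C≈))            = S , p , C≈
inst-at (position _ _ _ (⊥-left S C≈))             = S , C≈
inst-at (position _ _ _ (⇒-left S φ ψ C≈ _ _))     = S , φ , ψ , C≈ , ≈-refl , ≈-refl
inst-at (position _ _ _ (⇒-right S φ ψ C≈ _))      = S , φ , ψ , C≈ , ≈-refl
inst-at (position _ _ _ (reflexivity S φ C≈ _))    = S , φ , C≈ , ≈-refl
inst-at (position _ cs _ (□-right S Π φ C≈ _ (back k∈H))) =
  S , Π , φ , C≈ , ≈-refl , subst (_≈ goal (Π , φ)) (sym (companion-sequent k∈H cs)) ≈-refl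
inst-at (position _ _ _ (□-right S Π φ C≈ _ (fresh _))) = S , Π , φ , C≈ , ≈-refl , ≈-refl

premise-shrinks : ∀ p i → i < arity (rule-at p) →
                  (rule-at p ≡ Box × i ≡ 1) ⊎ size (derivation (premise p i)) < size (derivation p)
premise-shrinks (position _ _ _ (⇒-left _ _ _ _ d₀ d₁)) 0 _ = inj₂ (s≤s (m≤m⊔n _ _))
premise-shrinks (position _ _ _ (⇒-left _ _ _ _ d₀ d₁)) 1 _ = inj₂ (s≤s (m≤n⊔m (size d₀) _))
premise-shrinks (position _ _ _ (⇒-right _ _ _ _ _))    0 _ = inj₂ ≤-refl
premise-shrinks (position _ _ _ (reflexivity _ _ _ _))  0 _ = inj₂ ≤-refl
premise-shrinks (position _ _ _ (□-right _ _ _ _ _ _))  0 _ = inj₂ ≤-refl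
premise-shrinks (position _ _ _ (□-right _ _ _ _ _ _))  1 _ = inj₁ (refl , refl)
premise-shrinks (position _ _ _ (⇒-left _ _ _ _ _ _)) (suc (suc _)) (s≤s (s≤s ()))
premise-shrinks (position _ _ _ (⇒-right _ _ _ _ _))  (suc _) (s≤s ())
premise-shrinks (position _ _ _ (reflexivity _ _ _ _)) (suc _) (s≤s ())
premise-shrinks (position _ _ _ (□-right _ _ _ _ _ _)) (suc (suc _)) (s≤s (s≤s ()))

inst-resp-premises : ∀ r {C P Q} → (∀ i → P i ≡ Q i) → Inst r C P → Inst r C Q
inst-resp-premises Ax   _ I = I
inst-resp-premises bot• _ I = I
inst-resp-premises imp• P≡Q (S , φ , ψ , C≈ , P₀≈ , P₁≈) =
  S , φ , ψ , C≈ , subst (_≈ _) (P≡Q 0) P₀≈ , subst (_≈ _) (P≡Q 1) P₁≈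
inst-resp-premises imp∘ P≡Q (S , φ , ψ , C≈ , P₀≈) = S , φ , ψ , C≈ , subst (_≈ _) (P≡Q 0) P₀≈
inst-resp-premises Refl P≡Q (S , φ , C≈ , P₀≈)     = S , φ , C≈ , subst (_≈ _) (P≡Q 0) P₀≈
inst-resp-premises Box  P≡Q (S , Π , φ , C≈ , P₀≈ , P₁≈) =
  S , Π , φ , C≈ , subst (_≈ _) (P≡Q 0) P₀≈ , subst (_≈ _) (P≡Q 1) P₁≈
inst-resp-premises Cut  P≡Q (S , φ , C≈ , P₀≈ , P₁≈) =
  S , φ , C≈ , subst (_≈ _) (P≡Q 0) P₀≈ , subst (_≈ _) (P≡Q 1) P₁≈

module Unfolding (p₀ : Position) where

  at : Word → Position
  at = foldl premise p₀

  at-∷ʳ : ∀ w i → at (w ++ i ∷ []) ≡ premise (at w) i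
  at-∷ʳ w i = foldl-++ premise p₀ w (i ∷ [])

  unfolded : PreProof
  unfolded = record { seq = λ w → sequent (at w) ; rule = λ w → rule-at (at w) }

  correct-unfolded : LocallyCorrect unfolded
  correct-unfolded w _ = inst-resp-premises (rule-at (at w))
    (λ i → cong sequent (sym (at-∷ʳ w i))) (inst-at (at w))

  child-index< : ∀ {u} → Node unfolded u → ∀ w i → u ≡ w ++ i ∷ [] → i < arity (rule-at (at w))
  child-index< root            []      _ ()
  child-index< root            (_ ∷ _) _ ()
  child-index< (child j _ j<) w       i eq with refl , refl ← ∷ʳ-injective _ w eq = j<

  module _ (b : ℕ → ℕ) (nodes : ∀ n → Node unfolded (branch b n)) where
    size-at : ℕ → ℕ
    size-at n = size (derivation (at (branch b n)))

    size-drops-or-right-□ : ∀ n →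
      size-at (suc n) < size-at n ⊎ RightBoxPremise unfolded (branch b (suc n))
    size-drops-or-right-□ n
      with premise-shrinks (at (branch b n)) (b n) (child-index< (nodes (suc n)) (branch b n) (b n) refl)
    ... | inj₁ (rule≡Box , bn≡1) =
      inj₂ (branch b n , cong (λ j → branch b n ++ j ∷ []) bn≡1 , rule≡Box)
    ... | inj₂ shrinks =
      inj₁ (subst (λ p → size (derivation p) < size-at n) (sym (at-∷ʳ (branch b n) (b n))) shrinks)

    right-□-premise-within : ∀ k n → size-at n ≤ k →
                             ∃[ m ] (n < m × RightBoxPremise unfolded (branch b m))
    right-□-premise-within k n size≤k with size-drops-or-right-□ n | k
    ... | inj₂ right | _     = suc n , ≤-refl , right
    ... | inj₁ drops | zero  = ⊥-elim (n≮0 (<-≤-trans drops size≤k))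
    ... | inj₁ drops | suc k
      with m , n<m , right ← right-□-premise-within k (suc n) (≤-pred (<-≤-trans drops size≤k))
      = m , <⇒≤ n<m , right

  progressing-unfolded : Progressing unfolded
  progressing-unfolded b nodes n with m , n<m , right ← right-□-premise-within b nodes _ n ≤-refl
    = m , <⇒≤ n<m , right

  proof : Proof
  proof = record { tree = unfolded ; correct = correct-unfolded ; progressing = progressing-unfolded }

  cut-free : ∀ w → rule (tree proof) w ≢ Cut
  cut-free w = rule-at≢Cut (at w)

unfold : ∀ {S} → Derivation [] S → Σ Proof λ π → π ⊢ S × (∀ w → rule (tree π) w ≢ Cut)
unfold {S} d = Unfolding.proof p , ≈-refl , Unfolding.cut-free p
  where
  p : Position
  p = position [] tt S d

-- Finiteness of the search space

module _ {A : Set} where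

  ∈⇒↭∷ : ∀ {x : A} {xs} → x ∈ xs → ∃[ ys ] (xs ↭ x ∷ ys)
  ∈⇒↭∷ x∈xs with ys , zs , refl ← ∈-∃++ x∈xs = ys ++ zs , shift _ ys zs

  length-unique-≤ : ∀ {xs ys : List A} → Unique xs → All (_∈ ys) xs → length xs ≤ length ys
  length-unique-≤ {[]}     _             _              = z≤n
  length-unique-≤ {x ∷ xs} (x∉xs ∷ xs!) (x∈ys ∷ xs⊆ys) with ys′ , ρ ← ∈⇒↭∷ x∈ys =
    subst (suc (length xs) ≤_) (sym (↭-length ρ)) (s≤s (length-unique-≤ xs! xs⊆ys′))
    where
    drop-head : ∀ {y} → x ≢ y → y ∈ x ∷ ys′ → y ∈ ys′
    drop-head x≢y (here refl) = ⊥-elim (x≢y refl)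
    drop-head _   (there y∈)  = y∈

    xs⊆ys′ : All (_∈ ys′) xs
    xs⊆ys′ = All.zipWith (λ (x≢y , y∈ys) → drop-head x≢y (∈-resp-↭ ρ y∈ys)) (x∉xs , xs⊆ys)

  lists≤ : ℕ → List A → List (List A)
  lists≤ zero    xs = [ [] ]
  lists≤ (suc n) xs = [] ∷ cartesianProductWith _∷_ xs (lists≤ n xs)

  ∈-lists≤ : ∀ n {xs ys} → All (_∈ xs) ys → length ys ≤ n → ys ∈ lists≤ n xs
  ∈-lists≤ zero    {ys = []}    _             _           = here refl
  ∈-lists≤ (suc n) {ys = []}    _             _           = here refl
  ∈-lists≤ (suc n) {ys = y ∷ ys} (y∈xs ∷ ys⊆) (s≤s len≤n) =
    there (∈-cartesianProductWith⁺ _∷_ y∈xs (∈-lists≤ n ys⊆ len≤n))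

module _ {A B : Set} {P : B → Set} {Q : A → B → Set} where

  gather : ∀ {xs} → All (λ x → Σ B λ b → P b × Q x b) xs →
           Σ (List B) λ bs → All P bs × All (λ x → Any (Q x) bs) xs
  gather []                     = [] , [] , []
  gather ((b , Pb , Qxb) ∷ rest) with bs , Pbs , Qbs ← gather rest =
    b ∷ bs , Pb ∷ Pbs , here Qxb ∷ All.map there Qbs

data _◃_ : Fm → Fm → Set where
  ◃⇒ˡ : ∀ {φ ψ} → φ ◃ (φ ⇒ ψ)
  ◃⇒ʳ : ∀ {φ ψ} → ψ ◃ (φ ⇒ ψ)
  ◃□  : ∀ {φ} → φ ◃ box φ

SubformulaClosed : List Fm → Set
SubformulaClosed Sub = ∀ {θ φ} → θ ∈ Sub → φ ◃ θ → φ ∈ Sub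

subformulas : Fm → List Fm
subformulas (var p) = [ var p ]
subformulas bot     = [ bot ]
subformulas (φ ⇒ ψ) = (φ ⇒ ψ) ∷ subformulas φ ++ subformulas ψ
subformulas (box φ) = box φ ∷ subformulas φ

∈-subformulas : ∀ φ → φ ∈ subformulas φ
∈-subformulas (var p) = here refl
∈-subformulas bot     = here refl
∈-subformulas (φ ⇒ ψ) = here refl
∈-subformulas (box φ) = here refl

closed-++ : ∀ {A B} → SubformulaClosed A → SubformulaClosed B → SubformulaClosed (A ++ B)
closed-++ {A} closedA closedB θ∈ φ◃θ with ∈-++⁻ A θ∈
... | inj₁ θ∈A = ∈-++⁺ˡ (closedA θ∈A φ◃θ)
... | inj₂ θ∈B = ∈-++⁺ʳ A (closedB θ∈B φ◃θ)

subformulas-closed : ∀ θ → SubformulaClosed (subformulas θ)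
subformulas-closed (var p) (here refl) ()
subformulas-closed bot     (here refl) ()
subformulas-closed (φ ⇒ ψ) (here refl) ◃⇒ˡ = there (∈-++⁺ˡ (∈-subformulas φ))
subformulas-closed (φ ⇒ ψ) (here refl) ◃⇒ʳ = there (∈-++⁺ʳ (subformulas φ) (∈-subformulas ψ))
subformulas-closed (φ ⇒ ψ) (there θ∈) φ◃θ =
  there (closed-++ (subformulas-closed φ) (subformulas-closed ψ) θ∈ φ◃θ)
subformulas-closed (box φ) (here refl) ◃□ = there (∈-subformulas φ)
subformulas-closed (box φ) (there θ∈) φ◃θ = there (subformulas-closed φ θ∈ φ◃θ)

subformulasᴸ : List Fm → List Fm
subformulasᴸ []      = []
subformulasᴸ (φ ∷ Γ) = subformulas φ ++ subformulasᴸ Γ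

subformulasᴸ-closed : ∀ Γ → SubformulaClosed (subformulasᴸ Γ)
subformulasᴸ-closed []      ()
subformulasᴸ-closed (φ ∷ Γ) = closed-++ (subformulas-closed φ) (subformulasᴸ-closed Γ)

⊆-subformulasᴸ : ∀ {Γ} → All (_∈ subformulasᴸ Γ) Γ
⊆-subformulasᴸ {[]}    = []
⊆-subformulasᴸ {φ ∷ Γ} =
  ∈-++⁺ˡ (∈-subformulas φ) ∷ All.map (∈-++⁺ʳ (subformulas φ)) (⊆-subformulasᴸ {Γ})

_≟ᶠ_ : DecidableEquality Fm
var p   ≟ᶠ var q     = map′ (cong var) (λ { refl → refl }) (p ℕ.≟ q)
bot     ≟ᶠ bot       = yes refl
(φ ⇒ ψ) ≟ᶠ (φ′ ⇒ ψ′) =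
  map′ (λ (φ≡ , ψ≡) → cong₂ _⇒_ φ≡ ψ≡) (λ { refl → refl , refl }) (φ ≟ᶠ φ′ ×-dec ψ ≟ᶠ ψ′)
box φ   ≟ᶠ box ψ     = map′ (cong box) (λ { refl → refl }) (φ ≟ᶠ ψ)
var _   ≟ᶠ bot       = no λ ()
var _   ≟ᶠ (_ ⇒ _)   = no λ ()
var _   ≟ᶠ box _     = no λ ()
bot     ≟ᶠ var _     = no λ ()
bot     ≟ᶠ (_ ⇒ _)   = no λ ()
bot     ≟ᶠ box _     = no λ ()
(_ ⇒ _) ≟ᶠ var _     = no λ ()
(_ ⇒ _) ≟ᶠ bot       = no λ ()
(_ ⇒ _) ≟ᶠ box _     = no λ ()
box _   ≟ᶠ var _     = no λ ()
box _   ≟ᶠ bot       = no λ ()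
box _   ≟ᶠ (_ ⇒ _)   = no λ ()

-- Proof search

module Search (Sub : List Fm) (closed : SubformulaClosed Sub) where

  open import Data.List.Membership.DecPropositional _≟ᶠ_ using () renaming (_∈?_ to _∈ᶠ?_)
  open import Data.List.Membership.DecPropositional ℕ._≟_ using () renaming (_∈?_ to _∈ℕ?_)
  open import Data.List.Membership.DecPropositional (×.≡-dec (List.≡-dec _≟ᶠ_) _≟ᶠ_)
    using () renaming (_∈?_ to _∈ᴳ?_)

  BoundedGoal : Goal → Set
  BoundedGoal (Π , φ) = Unique Π × All (λ π → box π ∈ Sub) Π × φ ∈ Sub

  boundedGoals : List Goal
  boundedGoals = cartesianProduct (lists≤ (length Sub) Sub) Sub

  ∈-boundedGoals : ∀ {k} → BoundedGoal k → k ∈ boundedGoals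
  ∈-boundedGoals {Π , φ} (Π! , □Π⊆ , φ∈) = ∈-cartesianProduct⁺ (∈-lists≤ _ Π⊆ (length-unique-≤ Π! Π⊆)) φ∈
    where
    Π⊆ : All (_∈ Sub) Π
    Π⊆ = All.map (λ □π∈ → closed □π∈ ◃□) □Π⊆

  record History (H : List Goal) (fuel : ℕ) : Set where
    field
      distinct      : Unique H
      bounded       : All BoundedGoal H
      fuel-suffices : length boundedGoals ≤ length H + fuel
  open History

  empty-history : History [] (length boundedGoals)
  empty-history = record { distinct = [] ; bounded = [] ; fuel-suffices = ≤-refl }

  push : ∀ {H f k} → History H (suc f) → BoundedGoal k → k ∉ H → History (k ∷ H) f
  push {H} {f} hist bk k∉H = record
    { distinct      = All.¬Any⇒All¬ H k∉H ∷ distinct hist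
    ; bounded       = bk ∷ bounded hist
    ; fuel-suffices = subst (length boundedGoals ≤_) (+-suc (length H) f) (fuel-suffices hist) }

  out-of-fuel : ∀ {H k} → History H 0 → BoundedGoal k → k ∉ H → ⊥
  out-of-fuel {H} hist bk k∉H = n≮n (length H) (begin-strict
    length H                 <⟨ length-unique-≤ (All.¬Any⇒All¬ H k∉H ∷ distinct hist)
                                                (All.map ∈-boundedGoals (bk ∷ bounded hist)) ⟩
    length boundedGoals      ≤⟨ fuel-suffices hist ⟩
    length H + 0             ≡⟨ +-identityʳ (length H) ⟩
    length H                 ∎)
    where
    open ≤-Reasoning

  -- boxedˡ and boxedʳ hold the bodies of processed boxes.  A left box whose
  -- body is already in boxedˡ goes to spareˡ, keeping boxedˡ duplicate-free;
  -- spareʳ collects the ⊥'s on the right.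
  record Processed : Set where
    field
      varsˡ varsʳ   : List ℕ
      boxedˡ boxedʳ : List Fm
      spareˡ spareʳ : List Fm
  open Processed

  ∅ : Processed
  ∅ = record { varsˡ = [] ; varsʳ = [] ; boxedˡ = [] ; boxedʳ = [] ; spareˡ = [] ; spareʳ = [] }

  ⟦_⟧ : Processed → Sequent
  ⟦ σ ⟧ = map var (varsˡ σ) ++ (□ boxedˡ σ ++ spareˡ σ) , map var (varsʳ σ) ++ (□ boxedʳ σ ++ spareʳ σ)

  record State : Set where
    constructor _∥_
    field
      pending   : Sequent
      processed : Processed
  open State

  ⌜_⌝ : State → Sequent
  ⌜ P ∥ σ ⌝ = P ∪ ⟦ σ ⟧

  -- Boxes weigh 2 so that moving □φ from the pending right side to boxedʳ,
  -- where it weighs 1 + weight φ, and later re-examining φ both lose weight.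
  weight : Fm → ℕ
  weight (var _) = 1
  weight bot     = 1
  weight (φ ⇒ ψ) = suc (weight φ + weight ψ)
  weight (box φ) = 2 + weight φ

  stateWeight : State → ℕ
  stateWeight ((Γ , Δ) ∥ σ) =
    sum (map weight Γ) + sum (map weight Δ) + sum (map (suc ∘ weight) (boxedʳ σ))

  WellformedProcessed : Processed → Set
  WellformedProcessed σ =
    Unique (boxedˡ σ) × All (λ φ → box φ ∈ Sub) (boxedˡ σ) × All (_∈ Sub) (boxedʳ σ)

  Wellformed : State → Set
  Wellformed ((Γ , Δ) ∥ σ) = All (_∈ Sub) Γ × All (_∈ Sub) Δ × WellformedProcessed σ

  -- For a processed left box only □φ strictly above t is demanded: t ⊨ φ is
  -- recovered when the reflexivity step that made φ pending is undone.
  RefutesProcessed : Tree → Processed → Set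
  RefutesProcessed t σ =
    All (λ p → t ⊨ var p) (varsˡ σ) × All (λ p → t ⊭ var p) (varsʳ σ) ×
    All (t ⊨↑_) (boxedˡ σ) × All (λ φ → t ⊭ box φ) (boxedʳ σ)

  RefutesState : Tree → State → Set
  RefutesState t (P ∥ σ) = Refutes t P × RefutesProcessed t σ

  Outcome : List Goal → State → Set
  Outcome H s = (Σ Tree λ t → RefutesState t s) ⊎ Derivation H ⌜ s ⌝

  record Reduct (s : State) : Set where
    field
      state      : State
      wellformed : Wellformed state
      lighter    : stateWeight state < stateWeight s
      lift       : ∀ {t} → RefutesState t state → RefutesState t s
  open Reduct

  data Decomposition (s : State) : Set where
    closed-by : (∀ {H} → Derivation H ⌜ s ⌝) → Decomposition s
    unary     : (r : Reduct s) →
                (∀ {H} → Derivation H ⌜ state r ⌝ → Derivation H ⌜ s ⌝) → Decomposition s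
    binary    : (r₀ r₁ : Reduct s) →
                (∀ {H} → Derivation H ⌜ state r₀ ⌝ → Derivation H ⌜ state r₁ ⌝ → Derivation H ⌜ s ⌝) →
                Decomposition s

  resolve : ∀ {H s} → Decomposition s → ((r : Reduct s) → Outcome H (state r)) → Outcome H s
  resolve (closed-by d) _ = inj₂ d
  resolve (unary r build) search with search r
  ... | inj₁ (t , R) = inj₁ (t , lift r R)
  ... | inj₂ d       = inj₂ (build d)
  resolve (binary r₀ r₁ build) search with search r₀ | search r₁
  ... | inj₁ (t , R) | _            = inj₁ (t , lift r₀ R)
  ... | inj₂ _       | inj₁ (t , R) = inj₁ (t , lift r₁ R)
  ... | inj₂ d₀      | inj₂ d₁      = inj₂ (build d₀ d₁)

  private
    <-by : ∀ {m n} k → n ≡ suc (k + m) → m < n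
    <-by {m} k refl = s≤s (m≤n+m m k)

    ⇒-left-weight₀ : ∀ a b g d r → suc (a + b) + g + d + r ≡ suc (b + (g + (a + d) + r))
    ⇒-left-weight₀ = solve-∀

    ⇒-left-weight₁ : ∀ a b g d r → suc (a + b) + g + d + r ≡ suc (a + (b + g + d + r))
    ⇒-left-weight₁ = solve-∀

    ⇒-right-weight : ∀ a b g d r → g + (suc (a + b) + d) + r ≡ suc (a + g + (b + d) + r)
    ⇒-right-weight = solve-∀

    atom-right-weight : ∀ g d r → g + suc d + r ≡ suc (g + d + r)
    atom-right-weight = solve-∀

    □-right-weight : ∀ a g d r → g + suc (suc (a + d)) + r ≡ suc (g + d + (suc a + r))
    □-right-weight = solve-∀

  module _ (Γ Δ : List Fm) (σ : Processed) where

    private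
      S : Sequent
      S = ⌜ (Γ , Δ) ∥ σ ⌝

      Vˡ Vʳ Bˡ Bʳ : List Fm
      Vˡ = map var (varsˡ σ)
      Vʳ = map var (varsʳ σ)
      Bˡ = □ boxedˡ σ
      Bʳ = □ boxedʳ σ

      g d r : ℕ
      g = sum (map weight Γ)
      d = sum (map weight Δ)
      r = sum (map (suc ∘ weight) (boxedʳ σ))

    var-left-step : ∀ p → Wellformed ((var p ∷ Γ , Δ) ∥ σ) → Decomposition ((var p ∷ Γ , Δ) ∥ σ)
    var-left-step p (_ ∷ Γ⊆ , wf) = unary
      (record
        { state      = (Γ , Δ) ∥ record σ { varsˡ = p ∷ varsˡ σ }
        ; wellformed = Γ⊆ , wf
        ; lighter    = ≤-refl
        ; lift       = λ { ((⊨Γ , ⊭Δ) , ⊨p ∷ ⊨V , ρ) → (⊨p ∷ ⊨Γ , ⊭Δ) , ⊨V , ρ } })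
      (derivation-resp-≈ (↭-sym (shift (var p) Γ _) , ↭-refl))

    ⊥-left-step : Decomposition ((bot ∷ Γ , Δ) ∥ σ)
    ⊥-left-step = closed-by (⊥-left S (∷ˡ≈,• bot _ _))

    ⇒-left-step : ∀ φ ψ → Wellformed (((φ ⇒ ψ) ∷ Γ , Δ) ∥ σ) → Decomposition (((φ ⇒ ψ) ∷ Γ , Δ) ∥ σ)
    ⇒-left-step φ ψ (φ⇒ψ∈ ∷ Γ⊆ , Δ⊆ , wf) = binary
      (record
        { state      = (Γ , φ ∷ Δ) ∥ σ
        ; wellformed = Γ⊆ , closed φ⇒ψ∈ ◃⇒ˡ ∷ Δ⊆ , wf
        ; lighter    = <-by (weight ψ) (⇒-left-weight₀ (weight φ) (weight ψ) g d r)
        ; lift       = λ { {t} ((⊨Γ , ⊭φ ∷ ⊭Δ) , ρ) → (⊨⇒-introˡ t {φ} {ψ} ⊭φ ∷ ⊨Γ , ⊭Δ) , ρ } })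
      (record
        { state      = (ψ ∷ Γ , Δ) ∥ σ
        ; wellformed = closed φ⇒ψ∈ ◃⇒ʳ ∷ Γ⊆ , Δ⊆ , wf
        ; lighter    = <-by (weight φ) (⇒-left-weight₁ (weight φ) (weight ψ) g d r)
        ; lift       = λ { {t} ((⊨ψ ∷ ⊨Γ , ⊭Δ) , ρ) → (⊨⇒-introʳ t {φ} {ψ} ⊨ψ ∷ ⊨Γ , ⊭Δ) , ρ } })
      (λ d₀ d₁ → ⇒-left S φ ψ (∷ˡ≈,• (φ ⇒ ψ) _ _)
                   (derivation-resp-≈ (≈-sym (∷ʳ≈,∘ φ _ _)) d₀)
                   (derivation-resp-≈ (≈-sym (∷ˡ≈,• ψ _ _)) d₁))

    □-left-step : ∀ χ → Wellformed ((box χ ∷ Γ , Δ) ∥ σ) → Decomposition ((box χ ∷ Γ , Δ) ∥ σ)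
    □-left-step χ (□χ∈ ∷ Γ⊆ , Δ⊆ , B! , □B⊆ , R⊆) with χ ∈ᶠ? boxedˡ σ
    ... | no χ∉B = unary
      (record
        { state      = (χ ∷ Γ , Δ) ∥ record σ { boxedˡ = χ ∷ boxedˡ σ }
        ; wellformed = closed □χ∈ ◃□ ∷ Γ⊆ , Δ⊆ , All.¬Any⇒All¬ _ χ∉B ∷ B! , □χ∈ ∷ □B⊆ , R⊆
        ; lighter    = s≤s (n≤1+n _)
        ; lift       = λ { {t} ((⊨χ ∷ ⊨Γ , ⊭Δ) , ⊨V , ⊭Z , ⊨↑χ ∷ ⊨↑B , ⊭□R) →
                             (⊨□-intro t ⊨χ ⊨↑χ ∷ ⊨Γ , ⊭Δ) , ⊨V , ⊭Z , ⊨↑B , ⊭□R } })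
      (λ d → reflexivity S χ (∷ˡ≈,• (box χ) _ _) (derivation-resp-≈
        ( solve 6 (λ Γ Vˡ Bˡ Jˡ x y →
                     ((Γ ⊕ (Vˡ ⊕ (Bˡ ⊕ Jˡ))) ⊕ x) ⊕ y ⊜ x ⊕ (Γ ⊕ (Vˡ ⊕ (y ⊕ (Bˡ ⊕ Jˡ)))))
                  ↭-refl Γ Vˡ Bˡ (spareˡ σ) [ χ ] [ box χ ]
        , solve 1 (λ X → (X ⊕ id) ⊕ id ⊜ X) ↭-refl (Δ ++ proj₂ ⟦ σ ⟧)) d))
    ... | yes χ∈B = unary
      (record
        { state      = (χ ∷ Γ , Δ) ∥ record σ { spareˡ = box χ ∷ spareˡ σ }
        ; wellformed = closed □χ∈ ◃□ ∷ Γ⊆ , Δ⊆ , B! , □B⊆ , R⊆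
        ; lighter    = s≤s (n≤1+n _)
        ; lift       = λ { {t} ((⊨χ ∷ ⊨Γ , ⊭Δ) , ⊨V , ⊭Z , ⊨↑B , ⊭□R) →
                             (⊨□-intro t ⊨χ (All.lookup ⊨↑B χ∈B) ∷ ⊨Γ , ⊭Δ) , ⊨V , ⊭Z , ⊨↑B , ⊭□R } })
      (λ d → reflexivity S χ (∷ˡ≈,• (box χ) _ _) (derivation-resp-≈
        ( solve 6 (λ Γ Vˡ Bˡ Jˡ x y →
                     ((Γ ⊕ (Vˡ ⊕ (Bˡ ⊕ Jˡ))) ⊕ x) ⊕ y ⊜ x ⊕ (Γ ⊕ (Vˡ ⊕ (Bˡ ⊕ (y ⊕ Jˡ)))))
                  ↭-refl Γ Vˡ Bˡ (spareˡ σ) [ χ ] [ box χ ]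
        , solve 1 (λ X → (X ⊕ id) ⊕ id ⊜ X) ↭-refl (Δ ++ proj₂ ⟦ σ ⟧)) d))

    var-right-step : ∀ p → Wellformed ((Γ , var p ∷ Δ) ∥ σ) → Decomposition ((Γ , var p ∷ Δ) ∥ σ)
    var-right-step p (Γ⊆ , _ ∷ Δ⊆ , wf) = unary
      (record
        { state      = (Γ , Δ) ∥ record σ { varsʳ = p ∷ varsʳ σ }
        ; wellformed = Γ⊆ , Δ⊆ , wf
        ; lighter    = <-by 0 (atom-right-weight g d r)
        ; lift       = λ { ((⊨Γ , ⊭Δ) , ⊨V , ⊭p ∷ ⊭Z , ρ) → (⊨Γ , ⊭p ∷ ⊭Δ) , ⊨V , ⊭Z , ρ } })
      (derivation-resp-≈ (↭-refl , ↭-sym (shift (var p) Δ _)))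

    ⊥-right-step : Wellformed ((Γ , bot ∷ Δ) ∥ σ) → Decomposition ((Γ , bot ∷ Δ) ∥ σ)
    ⊥-right-step (Γ⊆ , _ ∷ Δ⊆ , wf) = unary
      (record
        { state      = (Γ , Δ) ∥ record σ { spareʳ = bot ∷ spareʳ σ }
        ; wellformed = Γ⊆ , Δ⊆ , wf
        ; lighter    = <-by 0 (atom-right-weight g d r)
        ; lift       = λ { ((⊨Γ , ⊭Δ) , ρ) → (⊨Γ , refl ∷ ⊭Δ) , ρ } })
      (derivation-resp-≈ (↭-refl ,
        solve 5 (λ Δ Vʳ Bʳ Jʳ x → x ⊕ (Δ ⊕ (Vʳ ⊕ (Bʳ ⊕ Jʳ))) ⊜ Δ ⊕ (Vʳ ⊕ (Bʳ ⊕ (x ⊕ Jʳ))))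
          ↭-refl Δ Vʳ Bʳ (spareʳ σ) [ bot ]))

    ⇒-right-step : ∀ φ ψ → Wellformed ((Γ , (φ ⇒ ψ) ∷ Δ) ∥ σ) → Decomposition ((Γ , (φ ⇒ ψ) ∷ Δ) ∥ σ)
    ⇒-right-step φ ψ (Γ⊆ , φ⇒ψ∈ ∷ Δ⊆ , wf) = unary
      (record
        { state      = (φ ∷ Γ , ψ ∷ Δ) ∥ σ
        ; wellformed = closed φ⇒ψ∈ ◃⇒ˡ ∷ Γ⊆ , closed φ⇒ψ∈ ◃⇒ʳ ∷ Δ⊆ , wf
        ; lighter    = <-by 0 (⇒-right-weight (weight φ) (weight ψ) g d r)
        ; lift       = λ { {t} ((⊨φ ∷ ⊨Γ , ⊭ψ ∷ ⊭Δ) , ρ) → (⊨Γ , ⊭⇒-intro t {φ} {ψ} ⊨φ ⊭ψ ∷ ⊭Δ) , ρ } })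
      (λ d → ⇒-right S φ ψ (∷ʳ≈,∘ (φ ⇒ ψ) _ _) (derivation-resp-≈ (≈-sym (∷∷≈,•,∘ φ ψ _ _)) d))

    □-right-postpone : ∀ χ → Wellformed ((Γ , box χ ∷ Δ) ∥ σ) → Decomposition ((Γ , box χ ∷ Δ) ∥ σ)
    □-right-postpone χ (Γ⊆ , □χ∈ ∷ Δ⊆ , B! , □B⊆ , R⊆) = unary
      (record
        { state      = (Γ , Δ) ∥ record σ { boxedʳ = χ ∷ boxedʳ σ }
        ; wellformed = Γ⊆ , Δ⊆ , B! , □B⊆ , closed □χ∈ ◃□ ∷ R⊆
        ; lighter    = <-by 0 (□-right-weight (weight χ) g d r)
        ; lift       = λ { ((⊨Γ , ⊭Δ) , ⊨V , ⊭Z , ⊨↑B , ⊭□χ ∷ ⊭□R) →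
                             (⊨Γ , ⊭□χ ∷ ⊭Δ) , ⊨V , ⊭Z , ⊨↑B , ⊭□R } })
      (derivation-resp-≈ (↭-refl ,
        solve 5 (λ Δ Vʳ Bʳ Jʳ x → x ⊕ (Δ ⊕ (Vʳ ⊕ (Bʳ ⊕ Jʳ))) ⊜ Δ ⊕ (Vʳ ⊕ (x ⊕ (Bʳ ⊕ Jʳ))))
          ↭-refl Δ Vʳ Bʳ (spareʳ σ) [ box χ ]))

  decomposeˡ : ∀ θ Γ Δ σ → Wellformed ((θ ∷ Γ , Δ) ∥ σ) → Decomposition ((θ ∷ Γ , Δ) ∥ σ)
  decomposeˡ (var p) Γ Δ σ = var-left-step Γ Δ σ p
  decomposeˡ bot     Γ Δ σ = λ _ → ⊥-left-step Γ Δ σ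
  decomposeˡ (φ ⇒ ψ) Γ Δ σ = ⇒-left-step Γ Δ σ φ ψ
  decomposeˡ (box χ) Γ Δ σ = □-left-step Γ Δ σ χ

  decomposeʳ : ∀ θ Γ Δ σ → Wellformed ((Γ , θ ∷ Δ) ∥ σ) → Decomposition ((Γ , θ ∷ Δ) ∥ σ)
  decomposeʳ (var p) Γ Δ σ = var-right-step Γ Δ σ p
  decomposeʳ bot     Γ Δ σ = ⊥-right-step Γ Δ σ
  decomposeʳ (φ ⇒ ψ) Γ Δ σ = ⇒-right-step Γ Δ σ φ ψ
  decomposeʳ (box χ) Γ Δ σ = □-right-postpone Γ Δ σ χ

  shared-variable-axiom : ∀ {H} σ → Any (_∈ varsˡ σ) (varsʳ σ) → Derivation H ⌜ ([] , []) ∥ σ ⌝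
  shared-variable-axiom σ shared
    with p , p∈Z , p∈V ← find shared
    with Vˡ , ρˡ ← ∈⇒↭∷ p∈V
    with Vʳ , ρʳ ← ∈⇒↭∷ p∈Z
    = axiom (map var Vˡ ++ (□ boxedˡ σ ++ spareˡ σ) , map var Vʳ ++ (□ boxedʳ σ ++ spareʳ σ)) p
        (≈-trans (++⁺ʳ _ (map⁺ var ρˡ) , ++⁺ʳ _ (map⁺ var ρʳ)) (∷∷≈,•,∘ (var p) (var p) _ _))

  RefutedGoal : Goal → Set
  RefutedGoal (Π , χ) = Σ Tree λ c → All (λ π → c ⊨ box π) Π × c ⊭ box χ

  saturated-countermodel : ∀ σ → All (_∉ varsˡ σ) (varsʳ σ) →
    All (λ χ → RefutedGoal (boxedˡ σ , χ)) (boxedʳ σ) → Σ Tree λ t → RefutesState t (([] , []) ∥ σ)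
  saturated-countermodel σ disjoint refuted with ts , ⊨□B , ⊭□R ← gather refuted =
    node (λ p → does (p ∈ℕ? varsˡ σ)) ts , ([] , []) ,
    All.tabulate (λ {p} → dec-true (p ∈ℕ? varsˡ σ)) ,
    All.map (λ {p} → dec-false (p ∈ℕ? varsˡ σ)) disjoint ,
    All.map evalBoxAll-true (All.All-swap ⊨□B) ,
    All.map (node-⊭□ _ ts) ⊭□R

  module _ (σ : Processed) (χ : Fm) (rest : List Fm) (ρ : boxedʳ σ ↭ χ ∷ rest) where

    □-premise : Wellformed (([] , []) ∥ σ) → Reduct (([] , []) ∥ σ)
    □-premise (_ , _ , B! , □B⊆ , R⊆) = record
      { state      = ([] , [ χ ]) ∥ record σ { boxedʳ = rest }
      ; wellformed = [] , All.head R⊆′ ∷ [] , B! , □B⊆ , All.tail R⊆′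
      ; lighter    = begin-strict
          weight χ + 0 + sum (map (suc ∘ weight) rest)  ≡⟨ cong (_+ _) (+-identityʳ (weight χ)) ⟩
          weight χ + sum (map (suc ∘ weight) rest)      <⟨ n<1+n _ ⟩
          sum (map (suc ∘ weight) (χ ∷ rest))           ≡⟨ sum-↭ (map⁺ (suc ∘ weight) (↭-sym ρ)) ⟩
          sum (map (suc ∘ weight) (boxedʳ σ))           ∎
      ; lift       = λ { {t} ((_ , ⊭χ ∷ []) , ⊨V , ⊭Z , ⊨↑B , ⊭□rest) →
                           ([] , []) , ⊨V , ⊭Z , ⊨↑B , All-resp-↭ (↭-sym ρ) (⊭□-intro t ⊭χ ∷ ⊭□rest) } }
      where
      open ≤-Reasoning
      R⊆′ : All (_∈ Sub) (χ ∷ rest)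
      R⊆′ = All-resp-↭ ρ R⊆

    □-conclusion : ∀ {H} → Derivation H ⌜ ([] , [ χ ]) ∥ record σ { boxedʳ = rest } ⌝ →
                   BoxPremise H (boxedˡ σ , χ) → Derivation H ⌜ ([] , []) ∥ σ ⌝
    □-conclusion d₀ = □-right S (boxedˡ σ) χ
      ( solve 3 (λ Vˡ Bˡ Jˡ → Vˡ ⊕ (Bˡ ⊕ Jˡ) ⊜ ((Vˡ ⊕ Jˡ) ⊕ Bˡ) ⊕ id) ↭-refl Vˡ Bˡ (spareˡ σ)
      , ↭-trans (++⁺ˡ Vʳ (++⁺ʳ (spareʳ σ) (map⁺ box ρ)))
          (solve 4 (λ Vʳ R Jʳ x → Vʳ ⊕ ((x ⊕ R) ⊕ Jʳ) ⊜ ((Vʳ ⊕ (R ⊕ Jʳ)) ⊕ id) ⊕ x)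
             ↭-refl Vʳ (□ rest) (spareʳ σ) [ box χ ]))
      (derivation-resp-≈
        ( solve 3 (λ Vˡ Bˡ Jˡ → ((Vˡ ⊕ Jˡ) ⊕ Bˡ) ⊕ id ⊜ Vˡ ⊕ (Bˡ ⊕ Jˡ)) ↭-refl Vˡ Bˡ (spareˡ σ)
        , solve 4 (λ Vʳ R Jʳ x → ((Vʳ ⊕ (R ⊕ Jʳ)) ⊕ id) ⊕ x ⊜ x ⊕ (Vʳ ⊕ (R ⊕ Jʳ)))
            ↭-refl Vʳ (□ rest) (spareʳ σ) [ χ ])
        d₀)
      where
      Vˡ Vʳ Bˡ : List Fm
      Vˡ = map var (varsˡ σ)
      Vʳ = map var (varsʳ σ)
      Bˡ = □ boxedˡ σ

      S : Sequent
      S = (Vˡ ++ spareˡ σ , Vʳ ++ (□ rest ++ spareʳ σ))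

  mutual
    search : ∀ f {H} → History H f → (s : State) → Wellformed s → Acc _<_ (stateWeight s) →
             Outcome H s
    search f hist ((θ ∷ Γ , Δ) ∥ σ) wf (acc rs) =
      resolve (decomposeˡ θ Γ Δ σ wf) λ r → search f hist (state r) (wellformed r) (rs (lighter r))
    search f hist (([] , θ ∷ Δ) ∥ σ) wf (acc rs) =
      resolve (decomposeʳ θ [] Δ σ wf) λ r → search f hist (state r) (wellformed r) (rs (lighter r))
    search f {H} hist (([] , []) ∥ σ) wf@(_ , _ , B! , □B⊆ , R⊆) (acc rs)
      with any? (_∈ℕ? varsˡ σ) (varsʳ σ)
    ... | yes shared  = inj₂ (shared-variable-axiom σ shared)
    ... | no disjoint =
      fromInj₁ (λ refuted → inj₁ (saturated-countermodel σ (All.¬Any⇒All¬ _ disjoint) refuted))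
        (All.sequenceA 0ℓ (SumLeft.applicative (Outcome H s) 0ℓ) (All.tabulate try-□))
      where
      s : State
      s = ([] , []) ∥ σ

      try-□-premises : ∀ {χ} (r : Reduct s) → BoundedGoal (boxedˡ σ , χ) →
        (∀ {H} → Derivation H ⌜ state r ⌝ → BoxPremise H (boxedˡ σ , χ) → Derivation H ⌜ s ⌝) →
        Outcome H s ⊎ RefutedGoal (boxedˡ σ , χ)
      try-□-premises {χ} r bounded-goal conclude
        with search f hist (state r) (wellformed r) (rs (lighter r))
      ... | inj₁ (t , R) = inj₁ (inj₁ (t , lift r R))
      ... | inj₂ d₀ with (boxedˡ σ , χ) ∈ᴳ? H
      ...   | yes k∈H = inj₁ (inj₂ (conclude d₀ (back k∈H)))
      ...   | no k∉H with search-goal f hist bounded-goal k∉H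
      ...     | inj₁ refuted = inj₂ refuted
      ...     | inj₂ d₁      = inj₁ (inj₂ (conclude d₀ (fresh d₁)))

      try-□ : ∀ {χ} → χ ∈ boxedʳ σ → Outcome H s ⊎ RefutedGoal (boxedˡ σ , χ)
      try-□ {χ} χ∈R with rest , ρ ← ∈⇒↭∷ χ∈R =
        try-□-premises (□-premise σ χ rest ρ wf) (B! , □B⊆ , All.lookup R⊆ χ∈R)
                       (□-conclusion σ χ rest ρ)

    search-goal : ∀ f {H k} → History H f → BoundedGoal k → k ∉ H →
                  RefutedGoal k ⊎ Derivation (k ∷ H) (goal k)
    search-goal zero    hist bk k∉H = ⊥-elim (out-of-fuel hist bk k∉H)
    search-goal (suc f) {k = Π , χ} hist bk@(_ , □Π⊆ , χ∈) k∉H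
      with search-sequent f (push hist bk k∉H) (goal (Π , χ)) (All.++⁺ (All.map⁺ □Π⊆) []) (χ∈ ∷ [])
    ... | inj₁ (c , ⊨□Π , ⊭χ ∷ []) = inj₁ (c , All.map⁻ (All.++⁻ˡ (□ Π) ⊨□Π) , ⊭□-intro c ⊭χ)
    ... | inj₂ d                   = inj₂ d

    search-sequent : ∀ f {H} → History H f → ∀ S → All (_∈ Sub) (proj₁ S) → All (_∈ Sub) (proj₂ S) →
                     (Σ Tree λ t → Refutes t S) ⊎ Derivation H S
    search-sequent f hist (Γ , Δ) Γ⊆ Δ⊆
      with search f hist ((Γ , Δ) ∥ ∅) (Γ⊆ , Δ⊆ , [] , [] , []) (<-wellFounded _)
    ... | inj₁ (t , R , _) = inj₁ (t , R)
    ... | inj₂ d = inj₂ (derivation-resp-≈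
                          (↭-reflexive (sym (++-identityʳ Γ)) , ↭-reflexive (sym (++-identityʳ Δ))) d)

refute-or-derive : ∀ S → (Σ Tree λ t → Refutes t S) ⊎ Derivation [] S
refute-or-derive (Γ , Δ) = search-sequent _ empty-history (Γ , Δ) (All.++⁻ˡ Γ ΓΔ⊆) (All.++⁻ʳ Γ ΓΔ⊆)
  where
  open Search (subformulasᴸ (Γ ++ Δ)) (subformulasᴸ-closed (Γ ++ Δ))
  ΓΔ⊆ : All (_∈ subformulasᴸ (Γ ++ Δ)) (Γ ++ Δ)
  ΓΔ⊆ = ⊆-subformulasᴸ

completeness : ∀ S → (∀ t → ¬ Refutes t S) → Derivation [] S
completeness S valid with refute-or-derive S
... | inj₁ (t , R) = ⊥-elim (valid t R)
... | inj₂ d       = d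

lemma4p5 : Σ (Proof → Proof) (λ cutsUp →
    ∀ (π : Proof) (S : Sequent) → π ⊢ S → (cutsUp π ⊢ S) × NoCutInMain (cutsUp π))
lemma4p5 = proj₁ ∘ cut-free , λ π S π⊢S →
  let _ , ⊢root , no-cut = cut-free π in ≈-trans ⊢root π⊢S , λ w _ → no-cut w
  where
  cut-free : (π : Proof) → Σ Proof λ π′ → π′ ⊢ seq (tree π) [] × (∀ w → rule (tree π′) w ≢ Cut)
  cut-free π = unfold (completeness (seq (tree π) []) (soundness π))
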